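{- Let $R_1$ and $R_2$ be finite commutative local principal ideal rings with unity and $R=R_1\times R_2$ such that $\mathrm{diam}(\Gamma(R_1))=0$ and $\mathrm{diam}(\Gamma(R_2))=2$. Then $\overline{\Gamma(R)}$ is a divisor graph if and only if $R_1$ is an integral domain.
   Context: For a commutative ring $S$ with unity, $Z(S)$ is its set of zero divisors. The zero divisor graph $\Gamma(S)$ has vertex set $Z(S)\setminus\{0\}$, distinct $a,b$ adjacent iff $ab=0$; its complement $\overline{\Gamma(S)}$ has the same vertex set, distinct $a,b$ adjacent iff $ab\neq0$. The diameter $\mathrm{diam}$ of a graph is the maximum distance between two of its vertices; a graph with one vertex has diameter $0$, and (as in the paper) the empty zero divisor graph of an integral domain is also regarded as having diameter $0$. A local ring has a unique maximal ideal. A graph $G$ is a divisor graph if it is isomorphic to the graph $G(S)$ on some set $S$ of positive integers in which distinct $i,j$ are adjacent iff $i\mid j$ or $j\mid i$. -}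

module Defs where

open import Level using (0ℓ)
open import Data.Nat using (ℕ; zero; suc; _≤_; _<_)
open import Data.Nat.Divisibility using (_∣_)
open import Data.Fin using (Fin)
open import Data.Product using (Σ; ∃; _×_; _,_; proj₁; proj₂)
open import Data.Sum using (_⊎_)
open import Relation.Binary.PropositionalEquality using (_≡_; _≢_)
open import Relation.Nullary using (¬_)
open import Algebra.Core using (Op₁; Op₂)
open import Algebra.Structures using (IsCommutativeRing)
open import Function.Bundles using (_↔_; _⇔_)

record FiniteCommRing : Set₁ where
  infixl 6 _+_
  infixl 7 _*_
  field
    Carrier            : Set
    _+_ _*_            : Op₂ Carrier
    -_                 : Op₁ Carrier
    0# 1#              : Carrier
    isCommutativeRing  : IsCommutativeRing _≡_ _+_ _*_ -_ 0# 1#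
    card               : ℕ
    enum               : Fin card ↔ Carrier

module _ (R : FiniteCommRing) where
  open FiniteCommRing R

  record IsIdeal (I : Carrier → Set) : Set where
    field
      zero-mem : I 0#
      +-closed : ∀ {x y} → I x → I y → I (x + y)
      *-closed : ∀ r {x} → I x → I (r * x)

  IsPrincipal : (Carrier → Set) → Set
  IsPrincipal I = ∃ λ a → ∀ x → (I x ⇔ (∃ λ r → x ≡ r * a))

  IsPIR : Set₁
  IsPIR = ∀ (I : Carrier → Set) → IsIdeal I → IsPrincipal I

  IsMaximalIdeal : (Carrier → Set) → Set₁
  IsMaximalIdeal M =
    IsIdeal M × ¬ M 1# ×
    (∀ (J : Carrier → Set) → IsIdeal J → (∀ x → M x → J x) →
      (∀ x → J x → M x) ⊎ J 1#)

  IsLocal : Set₁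
  IsLocal = Σ (Carrier → Set) λ M → IsMaximalIdeal M ×
    (∀ (M′ : Carrier → Set) → IsMaximalIdeal M′ →
      (∀ x → M′ x → M x) × (∀ x → M x → M′ x))

  IsIntegralDomain : Set
  IsIntegralDomain = 1# ≢ 0# × (∀ a b → a * b ≡ 0# → a ≡ 0# ⊎ b ≡ 0#)

record Graph : Set₁ where
  field
    V    : Set
    Vert : V → Set
    Adj  : V → V → Set

-- Walk G k x y : a walk from x to y of length at most k
data Walk (G : Graph) : ℕ → Graph.V G → Graph.V G → Set where
  here : ∀ {k x} → Walk G k x x
  step : ∀ {k x y z} → Graph.Adj G x y → Walk G k y z → Walk G (suc k) x z

Diam≤ : Graph → ℕ → Set
Diam≤ G d = ∀ x y → Graph.Vert G x → Graph.Vert G y → Walk G d x y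

-- diam G = d : d is the least bound on all distances (the maximum distance).
-- (Empty graph / one vertex: diameter 0; disconnected graph: no finite d.)
HasDiam : Graph → ℕ → Set
HasDiam G d = Diam≤ G d × (∀ e → Diam≤ G e → d ≤ e)

-- G is a divisor graph: G is isomorphic to G(S) for some set S of positive
-- integers; here the isomorphism is ι, and S is its image.
IsDivisorGraph : Graph → Set
IsDivisorGraph G = Σ (V → ℕ) λ ι →
    (∀ v → Vert v → 0 < ι v)
  × (∀ u v → Vert u → Vert v → ι u ≡ ι v → u ≡ v)
  × (∀ u v → Vert u → Vert v → u ≢ v →
       (Adj u v ⇔ (ι u ∣ ι v ⊎ ι v ∣ ι u)))
  where open Graph G

module _ {A : Set} (_*_ : Op₂ A) (0# : A) where

  IsZeroDivisor : A → Set
  IsZeroDivisor a = ∃ λ b → b ≢ 0# × a * b ≡ 0#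

  ZDVertex : A → Set
  ZDVertex a = IsZeroDivisor a × a ≢ 0#

  ZDGraph : Graph
  ZDGraph = record
    { V = A ; Vert = ZDVertex
    ; Adj = λ a b → ZDVertex a × ZDVertex b × a ≢ b × a * b ≡ 0# }

  ZDGraphᶜ : Graph
  ZDGraphᶜ = record
    { V = A ; Vert = ZDVertex
    ; Adj = λ a b → ZDVertex a × ZDVertex b × a ≢ b × a * b ≢ 0# }

Γ : FiniteCommRing → Graph
Γ R = ZDGraph _*_ 0# where open FiniteCommRing R

Γᶜ-× : FiniteCommRing → FiniteCommRing → Graph
Γᶜ-× R₁ R₂ = ZDGraphᶜ {A = R₁.Carrier × R₂.Carrier}
    (λ x y → (proj₁ x R₁.* proj₁ y) , (proj₂ x R₂.* proj₂ y))
    (R₁.0# , R₂.0#)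
  where
    module R₁ = FiniteCommRing R₁
    module R₂ = FiniteCommRing R₂

-- When R₁ is a domain, (a , b) and (a′ , b′) are adjacent in the complement exactly when
-- a a′ ≠ 0 or b b′ ≠ 0.  In the local principal ideal ring R₂ every nonzero b is π^k · u with
-- u a unit and k below the nilpotency index n of a generator π of the maximal ideal, and
-- b b′ = 0 iff k + k′ ≥ n.  So adjacency only depends on whether a = 0 and on the exponents,
-- and the resulting comparability relation is realised by three linear orders; reading a
-- point (p , q , r) of ℕ³ as 2^p 3^q 5^r turns the realiser into a divisor labelling.
-- Conversely, if R₁ is not a domain then diam Γ(R₁) = 0 yields z ≠ 0 with z² = 0, and
-- diam Γ(R₂) = 2 yields an induced path x — w — y.  Divisibility orients the edges of a
-- divisor graph transitively, and following the orientations forced around eight vertices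
-- built from z, x, w, y reverses the edge between (1 , w) and (z , x), which is absurd.
module Submission where

open import Level using (0ℓ)
open import Axiom.ExcludedMiddle using (ExcludedMiddle)
open import Algebra.Bundles using (CommutativeRing)
open import Data.Nat as ℕ using (ℕ; zero; suc; s≤s; _<_; _≤_)
import Data.Nat.Properties as ℕ
open import Data.Nat.Divisibility using (_∣_; ∣-trans; ∣-antisym)
open import Data.Nat.Induction using (<-rec)
open import Data.Fin using (toℕ; combine)
open import Data.Fin.Properties using (pigeonhole; toℕ<n; toℕ-injective; combine-injective)
open import Data.List using (List; []; _∷_; map; filter; allFin)
open import Data.List.Membership.Propositional using (_∈_)
open import Data.List.Membership.Propositional.Properties using (∈-map⁺; ∈-allFin; ∈-filter⁺)
open import Data.List.Relation.Unary.Any using (here; there)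
open import Data.List.Relation.Unary.All using (lookup)
open import Data.List.Relation.Unary.All.Properties using (all-filter)
open import Data.List.Extrema ℕ.≤-totalOrder using (argmax; argmax-all; f[xs]≤f[argmax])
open import Data.Product using (∃; _×_; _,_; proj₁; proj₂)
open import Data.Product.Properties using (,-injectiveˡ; ,-injectiveʳ)
open import Data.Sum using (_⊎_; inj₁; inj₂; [_,_]; swap)
open import Data.Sum.Function.Propositional using (_⊎-⇔_)
open import Data.Unit using (⊤; tt)
open import Relation.Nullary using (¬_; yes; no; contradiction)
open import Relation.Nullary.Decidable using (from-yes; from-no)
open import Relation.Unary using (Decidable)
open import Relation.Binary.PropositionalEquality hiding ([_])
open import Function.Base using (_∘_)
open import Function.Bundles using (_⇔_; mk⇔; Inverse; Equivalence)
import Function.Properties.Equivalence as ⇔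
open import Defs

module ExponentVectors where

  open import Data.Nat
  open import Data.Nat.Properties
  open import Data.Nat.Divisibility
  open import Data.Nat.Primality
  open import Algebra.Properties.CommutativeSemigroup *-commutativeSemigroup
    using (x∙yz≈y∙xz; x∙yz≈z∙xy)

  ^-monoʳ-∣ : ∀ b {m n} → m ≤ n → b ^ m ∣ b ^ n
  ^-monoʳ-∣ b {n = n} z≤n       = 1∣ (b ^ n)
  ^-monoʳ-∣ b         (s≤s m≤n) = *-monoʳ-∣ b (^-monoʳ-∣ b m≤n)

  prime∤* : ∀ {p x y} → Prime p → ¬ p ∣ x → ¬ p ∣ y → ¬ p ∣ x * y
  prime∤* {x = x} {y} pp p∤x p∤y p∣xy with euclidsLemma x y pp p∣xy
  ... | inj₁ p∣x = p∤x p∣x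
  ... | inj₂ p∣y = p∤y p∣y

  prime∤^ : ∀ {p x} → Prime p → ¬ p ∣ x → ∀ k → ¬ p ∣ x ^ k
  prime∤^ pp p∤x zero    p∣1 = ¬prime[1] (subst Prime (∣1⇒≡1 p∣1) pp)
  prime∤^ pp p∤x (suc k) = prime∤* pp p∤x (prime∤^ pp p∤x k)

  ^*∣^*⇒≤ : ∀ p .{{_ : NonZero p}} {a b x y} → ¬ p ∣ y → p ^ a * x ∣ p ^ b * y → a ≤ b
  ^*∣^*⇒≤ p {a} {b} {x} {y} p∤y pᵃx∣pᵇy with a ≤? b
  ... | yes a≤b = a≤b
  ... | no  a≰b = contradiction (*-cancelˡ-∣ (p ^ b) {{m^n≢0 p b}} p^b*p∣p^b*y) p∤y
    where
    p^b*p∣p^b*y : p ^ b * p ∣ p ^ b * y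
    p^b*p∣p^b*y = ∣-trans (subst (_∣ p ^ a) (*-comm p (p ^ b)) (^-monoʳ-∣ p (≰⇒> a≰b)))
                          (∣-trans (m∣m*n x) pᵃx∣pᵇy)

  ℕ³ : Set
  ℕ³ = ℕ × ℕ × ℕ

  infix 4 _≤³_

  _≤³_ : ℕ³ → ℕ³ → Set
  (p , q , r) ≤³ (p′ , q′ , r′) = p ≤ p′ × q ≤ q′ × r ≤ r′

  ≤³-antisym : ∀ {u v} → u ≤³ v → v ≤³ u → u ≡ v
  ≤³-antisym {_ , _ , _} {_ , _ , _} (p≤ , q≤ , r≤) (≥p , ≥q , ≥r) =
    cong₂ _,_ (≤-antisym p≤ ≥p) (cong₂ _,_ (≤-antisym q≤ ≥q) (≤-antisym r≤ ≥r))

  ≤³-reflexive : ∀ {u v} → u ≡ v → u ≤³ v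
  ≤³-reflexive {_ , _ , _} refl = ≤-refl , ≤-refl , ≤-refl

  monomial : ℕ³ → ℕ
  monomial (p , q , r) = 2 ^ p * (3 ^ q * 5 ^ r)

  monomial-pos : ∀ u → 0 < monomial u
  monomial-pos (p , q , r) = *-mono-≤ (m^n>0 2 p) (*-mono-≤ (m^n>0 3 q) (m^n>0 5 r))

  monomial∣⇔≤³ : ∀ {u v} → monomial u ∣ monomial v ⇔ u ≤³ v
  monomial∣⇔≤³ {p , q , r} {p′ , q′ , r′} = mk⇔ exponents≤ monomial-mono
    where
    monomial-mono : (p , q , r) ≤³ (p′ , q′ , r′) → monomial (p , q , r) ∣ monomial (p′ , q′ , r′)
    monomial-mono (p≤ , q≤ , r≤) =
      *-pres-∣ (^-monoʳ-∣ 2 p≤) (*-pres-∣ (^-monoʳ-∣ 3 q≤) (^-monoʳ-∣ 5 r≤))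

    exponents≤ : monomial (p , q , r) ∣ monomial (p′ , q′ , r′) → (p , q , r) ≤³ (p′ , q′ , r′)
    exponents≤ u∣v =
        ^*∣^*⇒≤ 2 2∤3^q′5^r′ u∣v
      , ^*∣^*⇒≤ 3 3∤2^p′5^r′
          (subst₂ _∣_ (x∙yz≈y∙xz (2 ^ p) (3 ^ q) (5 ^ r)) (x∙yz≈y∙xz (2 ^ p′) (3 ^ q′) (5 ^ r′)) u∣v)
      , ^*∣^*⇒≤ 5 5∤2^p′3^q′
          (subst₂ _∣_ (x∙yz≈z∙xy (2 ^ p) (3 ^ q) (5 ^ r)) (x∙yz≈z∙xy (2 ^ p′) (3 ^ q′) (5 ^ r′)) u∣v)
      where
      pr2 : Prime 2
      pr2 = from-yes (prime? 2)
      pr3 : Prime 3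
      pr3 = from-yes (prime? 3)
      pr5 : Prime 5
      pr5 = from-yes (prime? 5)
      2∤3^q′5^r′ : ¬ 2 ∣ 3 ^ q′ * 5 ^ r′
      2∤3^q′5^r′ = prime∤* pr2 (prime∤^ pr2 (from-no (2 ∣? 3)) q′) (prime∤^ pr2 (from-no (2 ∣? 5)) r′)
      3∤2^p′5^r′ : ¬ 3 ∣ 2 ^ p′ * 5 ^ r′
      3∤2^p′5^r′ = prime∤* pr3 (prime∤^ pr3 (from-no (3 ∣? 2)) p′) (prime∤^ pr3 (from-no (3 ∣? 5)) r′)
      5∤2^p′3^q′ : ¬ 5 ∣ 2 ^ p′ * 3 ^ q′
      5∤2^p′3^q′ = prime∤* pr5 (prime∤^ pr5 (from-no (5 ∣? 2)) p′) (prime∤^ pr5 (from-no (5 ∣? 3)) q′)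

  monomial-injective : ∀ {u v} → monomial u ≡ monomial v → u ≡ v
  monomial-injective eq = ≤³-antisym (Equivalence.to monomial∣⇔≤³ (∣-reflexive eq))
                                     (Equivalence.to monomial∣⇔≤³ (∣-reflexive (sym eq)))

  Comparable : ℕ³ → ℕ³ → Set
  Comparable u v = u ≤³ v ⊎ v ≤³ u

module Realizer (n E : ℕ) where

  open import Data.Nat
  open import Data.Nat.Properties
  open ExponentVectors

  κ : ℕ → ℕ → ℕ
  κ k e = E * k + e

  κ<E*⇔< : ∀ {a b e} → e < E → κ a e < E * b ⇔ a < b
  κ<E*⇔< {a} {b} {e} e<E = mk⇔ to from
    where
    to : κ a e < E * b → a < b
    to κ<Eb with a <? b
    ... | yes a<b = a<b
    ... | no  a≮b = contradiction (≤-trans (*-monoʳ-≤ E (≮⇒≥ a≮b)) (m≤m+n (E * a) e)) (<⇒≱ κ<Eb)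
    from : a < b → κ a e < E * b
    from a<b = <-≤-trans (+-monoʳ-< (E * a) e<E)
      (subst (_≤ E * b) (trans (*-suc E a) (+-comm E (E * a))) (*-monoʳ-≤ E a<b))

  κ-monoˡ-< : ∀ {a b e e′} → e < E → a < b → κ a e < κ b e′
  κ-monoˡ-< {b = b} {e′ = e′} e<E a<b =
    ≤-trans (Equivalence.from (κ<E*⇔< e<E) a<b) (m≤m+n (E * b) e′)

  κ≤κ⇒≤ : ∀ {a b e e′} → e′ < E → κ a e ≤ κ b e′ → a ≤ b
  κ≤κ⇒≤ e′<E κ≤κ = ≮⇒≥ (λ b<a → <⇒≱ (κ-monoˡ-< e′<E b<a) κ≤κ)

  κ-injectiveʳ : ∀ {a b e e′} → e < E → e′ < E → κ a e ≡ κ b e′ → e ≡ e′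
  κ-injectiveʳ {a} {e = e} {e′} e<E e′<E eq
    with ≤-antisym (κ≤κ⇒≤ e′<E (≤-reflexive eq)) (κ≤κ⇒≤ e<E (≤-reflexive (sym eq)))
  ... | refl = +-cancelˡ-≡ (E * a) e e′ eq

  κ<E*n : ∀ {k e} → k < n → e < E → κ k e < E * n
  κ<E*n k<n e<E = Equivalence.from (κ<E*⇔< e<E) k<n

  -- α k e stands for a vertex (0 , b) and β k e for a vertex (a , b) with a ≠ 0, where k is
  -- the π-adic valuation of b and e < E is an index identifying the vertex.
  data Tag : Set where
    α β : (k e : ℕ) → Tag

  index : Tag → ℕ
  index (α _ e) = e
  index (β _ e) = e

  Valid : Tag → Set
  Valid (α k e) = k < n × e < E
  Valid (β _ e) = e < E

  Compatible : Tag → Tag → Set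
  Compatible (α k _) (α k′ _) = k + k′ < n
  Compatible (α k _) (β l _)  = k + l < n
  Compatible (β l _) (α k _)  = l + k < n
  Compatible (β _ _) (β _ _)  = ⊤

  height : ℕ → ℕ → ℕ
  height k e with n ≤? k + k
  ... | yes _ = suc (κ k e)
  ... | no  _ = E * (n ∸ k)

  -- The first and third coordinates both decrease along α-tags.  The middle one agrees with
  -- the first on α-tags with 2k < n and increases on those with 2k ≥ n, so two α-tags are
  -- comparable exactly when k + k′ < n.  β-tags form a chain with third coordinate 0, so they
  -- can only lie below α-tags, which the first coordinate allows exactly when l + k < n.
  code : Tag → ℕ³
  code (α k e) = E * (n ∸ k) , height k e , E * n ∸ κ k e
  code (β l e) = suc (κ l e) , 0 , 0

  β-comparable : ∀ l e l′ e′ → Comparable (code (β l e)) (code (β l′ e′))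
  β-comparable l e l′ e′ with ≤-total (suc (κ l e)) (suc (κ l′ e′))
  ... | inj₁ κ≤κ′ = inj₁ (κ≤κ′ , z≤n , z≤n)
  ... | inj₂ κ′≤κ = inj₂ (κ′≤κ , z≤n , z≤n)

  α≰β : ∀ {k e l e′} → Valid (α k e) → ¬ code (α k e) ≤³ code (β l e′)
  α≰β (k<n , e<E) (_ , _ , r≤0) = <⇒≱ (m<n⇒0<n∸m (κ<E*n k<n e<E)) r≤0

  β≤α⇔ : ∀ {k e l e′} → k < n → e′ < E → code (β l e′) ≤³ code (α k e) ⇔ l + k < n
  β≤α⇔ {l = l} k<n e′<E = mk⇔
    (λ (p≤ , _ , _) → m≤o∸n⇒m+n≤o (suc l) (<⇒≤ k<n) (Equivalence.to (κ<E*⇔< e′<E) p≤))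
    (λ l+k<n → Equivalence.from (κ<E*⇔< e′<E) (m+n≤o⇒m≤o∸n (suc l) l+k<n) , z≤n , z≤n)

  α≤α⇒κ≥ : ∀ {k e k′ e′} → Valid (α k′ e′) → code (α k e) ≤³ code (α k′ e′) → κ k′ e′ ≤ κ k e
  α≤α⇒κ≥ (k′<n , e′<E) (_ , _ , r≤) = ∸-cancelʳ-≤ (<⇒≤ (κ<E*n k′<n e′<E)) r≤

  α≤α⇒ : ∀ {k e k′ e′} → Valid (α k e) → Valid (α k′ e′) → e ≢ e′ →
         code (α k e) ≤³ code (α k′ e′) → k + k′ < n
  α≤α⇒ {k} {e} {k′} {e′} (_ , e<E) v′@(k′<n , e′<E) e≢e′ α≤α′ =
    height≤⇒ (α≤α⇒κ≥ v′ α≤α′) (proj₁ (proj₂ α≤α′))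
    where
    height≤⇒ : κ k′ e′ ≤ κ k e → height k e ≤ height k′ e′ → k + k′ < n
    height≤⇒ κ′≤κ h≤ with n ≤? k + k | n ≤? k′ + k′
    ... | yes _      | yes _       =
      contradiction (κ-injectiveʳ e<E e′<E (≤-antisym (s≤s⁻¹ h≤) κ′≤κ)) e≢e′
    ... | yes _      | no  _       = m≤o∸n⇒m+n≤o (suc k) (<⇒≤ k′<n) (Equivalence.to (κ<E*⇔< e<E) h≤)
    ... | no k+k≱n | yes n≤k′+k′ = contradiction (≤-trans n≤k′+k′ (+-mono-≤ k′≤k k′≤k)) k+k≱n
      where
      k′≤k : k′ ≤ k
      k′≤k = κ≤κ⇒≤ e<E κ′≤κ
    ... | no k+k≱n | no  _       = ≤-<-trans (+-monoʳ-≤ k (κ≤κ⇒≤ e<E κ′≤κ)) (≰⇒> k+k≱n)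

  α≤α⇐ : ∀ {k e k′ e′} → e < E → k + k′ < n → κ k′ e′ ≤ κ k e → code (α k e) ≤³ code (α k′ e′)
  α≤α⇐ {k} {e} {k′} {e′} e<E k+k′<n κ′≤κ = p≤ , q≤ , ∸-monoʳ-≤ (E * n) κ′≤κ
    where
    k′≤k : k′ ≤ k
    k′≤k = κ≤κ⇒≤ e<E κ′≤κ
    p≤ : E * (n ∸ k) ≤ E * (n ∸ k′)
    p≤ = *-monoʳ-≤ E (∸-monoʳ-≤ n k′≤k)
    q≤ : height k e ≤ height k′ e′
    q≤ with n ≤? k + k | n ≤? k′ + k′
    ... | _     | yes n≤k′+k′ = contradiction (≤-trans n≤k′+k′ (+-monoˡ-≤ k′ k′≤k)) (<⇒≱ k+k′<n)
    ... | yes _ | no  _       = Equivalence.from (κ<E*⇔< e<E) (m+n≤o⇒m≤o∸n (suc k) k+k′<n)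
    ... | no  _ | no  _       = p≤

  α-comparable : ∀ {k e k′ e′} → e < E → e′ < E → k + k′ < n →
                 Comparable (code (α k e)) (code (α k′ e′))
  α-comparable {k} {e} {k′} {e′} e<E e′<E k+k′<n with ≤-total (κ k′ e′) (κ k e)
  ... | inj₁ κ′≤κ = inj₁ (α≤α⇐ e<E k+k′<n κ′≤κ)
  ... | inj₂ κ≤κ′ = inj₂ (α≤α⇐ e′<E (subst (_< n) (+-comm k k′) k+k′<n) κ≤κ′)

  comparable⇔compatible : ∀ {s t} → Valid s → Valid t → index s ≢ index t →
                          Comparable (code s) (code t) ⇔ Compatible s t
  comparable⇔compatible {α k _} {α k′ _} v v′@(_ , e′<E) e≢e′ = mk⇔
    (λ { (inj₁ s≤t) → α≤α⇒ v v′ e≢e′ s≤t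
       ; (inj₂ t≤s) → subst (_< n) (+-comm k′ k) (α≤α⇒ v′ v (e≢e′ ∘ sym) t≤s) })
    (α-comparable (proj₂ v) e′<E)
  comparable⇔compatible {α k _} {β l _} v e′<E _ = mk⇔
    (λ { (inj₁ s≤t) → contradiction s≤t (α≰β v)
       ; (inj₂ t≤s) → subst (_< n) (+-comm l k) (Equivalence.to (β≤α⇔ (proj₁ v) e′<E) t≤s) })
    (λ k+l<n → inj₂ (Equivalence.from (β≤α⇔ (proj₁ v) e′<E) (subst (_< n) (+-comm k l) k+l<n)))
  comparable⇔compatible {β _ _} {α _ _} e<E v′ _ = mk⇔
    (λ { (inj₁ s≤t) → Equivalence.to (β≤α⇔ (proj₁ v′) e<E) s≤t
       ; (inj₂ t≤s) → contradiction t≤s (α≰β v′) })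
    (λ l+k<n → inj₁ (Equivalence.from (β≤α⇔ (proj₁ v′) e<E) l+k<n))
  comparable⇔compatible {β l e} {β l′ e′} _ _ _ = mk⇔ (λ _ → tt) (λ _ → β-comparable l e l′ e′)

  code-injective : ∀ {s t} → Valid s → Valid t → code s ≡ code t → index s ≡ index t
  code-injective {α _ _} {α _ _} (k<n , e<E) (k′<n , e′<E) eq =
    κ-injectiveʳ e<E e′<E
      (∸-cancelˡ-≡ (<⇒≤ (κ<E*n k<n e<E)) (<⇒≤ (κ<E*n k′<n e′<E)) (cong (proj₂ ∘ proj₂) eq))
  code-injective {α _ _} {β _ _} v _ eq = contradiction (≤³-reflexive eq) (α≰β v)
  code-injective {β _ _} {α _ _} _ v′ eq = contradiction (≤³-reflexive (sym eq)) (α≰β v′)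
  code-injective {β _ _} {β _ _} e<E e′<E eq = κ-injectiveʳ e<E e′<E (suc-injective (cong proj₁ eq))

module Classical (em : ExcludedMiddle 0ℓ) where

  open import Data.Nat
  open import Data.Nat.Properties

  IsLeast : (ℕ → Set) → ℕ → Set
  IsLeast P n = P n × (∀ {k} → k < n → ¬ P k)

  least : ∀ {P : ℕ → Set} m → P m → ∃ (IsLeast P)
  least {P} = <-rec (λ m → P m → ∃ (IsLeast P)) least-from
    where
    least-from : ∀ m → (∀ {k} → k < m → P k → ∃ (IsLeast P)) → P m → ∃ (IsLeast P)
    least-from m rec Pm with em {∃ λ k → k < m × P k}
    ... | yes (k , k<m , Pk) = rec k<m Pk
    ... | no  ∄k             = m , Pm , λ k<m Pk → ∄k (_ , k<m , Pk)

  module _ {A : Set} where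

    count : (A → Set) → List A → ℕ
    count P []       = 0
    count P (x ∷ xs) with em {P x}
    ... | yes _ = suc (count P xs)
    ... | no  _ = count P xs

    count-mono : ∀ {P Q : A → Set} → (∀ {x} → P x → Q x) → ∀ xs → count P xs ≤ count Q xs
    count-mono P⊆Q []       = z≤n
    count-mono {P} {Q} P⊆Q (x ∷ xs) with em {P x} | em {Q x}
    ... | yes _  | yes _  = s≤s (count-mono P⊆Q xs)
    ... | yes Px | no ¬Qx = contradiction (P⊆Q Px) ¬Qx
    ... | no  _  | yes _  = m≤n⇒m≤1+n (count-mono P⊆Q xs)
    ... | no  _  | no  _  = count-mono P⊆Q xs

    count-mono-< : ∀ {P Q : A → Set} {y xs} → (∀ {x} → P x → Q x) → y ∈ xs → Q y → ¬ P y →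
                   count P xs < count Q xs
    count-mono-< {P} {Q} {xs = x ∷ xs} P⊆Q (here refl) Qy ¬Py with em {P x} | em {Q x}
    ... | yes Py | _      = contradiction Py ¬Py
    ... | no  _  | yes _  = s≤s (count-mono P⊆Q xs)
    ... | no  _  | no ¬Qy = contradiction Qy ¬Qy
    count-mono-< {P} {Q} {xs = x ∷ xs} P⊆Q (there y∈xs) Qy ¬Py with em {P x} | em {Q x}
    ... | yes _  | yes _  = s≤s (count-mono-< P⊆Q y∈xs Qy ¬Py)
    ... | yes Px | no ¬Qx = contradiction (P⊆Q Px) ¬Qx
    ... | no  _  | yes _  = m<n⇒m<1+n (count-mono-< P⊆Q y∈xs Qy ¬Py)
    ... | no  _  | no  _  = count-mono-< P⊆Q y∈xs Qy ¬Py

module FiniteCommRingProperties (R : FiniteCommRing) where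

  open FiniteCommRing R public

  commutativeRing : CommutativeRing 0ℓ 0ℓ
  commutativeRing = record { isCommutativeRing = isCommutativeRing }

  open CommutativeRing commutativeRing public
    using ( +-assoc; +-identityʳ; -‿inverseˡ; -‿inverseʳ
          ; *-comm; *-assoc; *-identityˡ; *-identityʳ; zeroˡ; zeroʳ; distribˡ; distribʳ
          ; ring; semiring; *-commutativeSemigroup)
  open import Algebra.Properties.Ring ring public using (-‿distribʳ-*)
  open import Algebra.Properties.Semiring.Exp semiring public using (_^_; ^-homo-*)
  open import Algebra.Properties.CommutativeSemigroup *-commutativeSemigroup public
    using (interchange)

  from-injective : ∀ {x y} → Inverse.from enum x ≡ Inverse.from enum y → x ≡ y
  from-injective {x} {y} eq = begin
    x                                     ≡⟨ sym (Inverse.strictlyInverseˡ enum x) ⟩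
    Inverse.to enum (Inverse.from enum x) ≡⟨ cong (Inverse.to enum) eq ⟩
    Inverse.to enum (Inverse.from enum y) ≡⟨ Inverse.strictlyInverseˡ enum y ⟩
    y                                     ∎
    where open ≡-Reasoning

  ≢0⇒1≢0 : ∀ {x} → x ≢ 0# → 1# ≢ 0#
  ≢0⇒1≢0 {x} x≢0 1≡0 = x≢0 (trans (sym (*-identityʳ x)) (trans (cong (x *_) 1≡0) (zeroʳ x)))

  *1≢0 : ∀ {x} → x ≢ 0# → x * 1# ≢ 0#
  *1≢0 {x} x≢0 = x≢0 ∘ trans (sym (*-identityʳ x))

  1*≢0 : ∀ {x} → x ≢ 0# → 1# * x ≢ 0#
  1*≢0 {x} x≢0 = x≢0 ∘ trans (sym (*-identityˡ x))

  elements : List Carrier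
  elements = map (Inverse.to enum) (allFin card)

  ∈-elements : ∀ x → x ∈ elements
  ∈-elements x = subst (_∈ elements) (Inverse.strictlyInverseˡ enum x) (∈-map⁺ _ (∈-allFin _))

  Unit : Carrier → Set
  Unit u = ∃ λ v → u * v ≡ 1#

  unit-* : ∀ {u v} → Unit u → Unit v → Unit (u * v)
  unit-* {u} {v} (u⁻¹ , uu⁻¹) (v⁻¹ , vv⁻¹) = u⁻¹ * v⁻¹ , (begin
    (u * v) * (u⁻¹ * v⁻¹) ≡⟨ interchange u v u⁻¹ v⁻¹ ⟩
    (u * u⁻¹) * (v * v⁻¹) ≡⟨ cong₂ _*_ uu⁻¹ vv⁻¹ ⟩
    1# * 1#               ≡⟨ *-identityˡ 1# ⟩
    1#                    ∎)
    where open ≡-Reasoning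

  *-unit≡0⇒≡0 : ∀ {x u} → Unit u → x * u ≡ 0# → x ≡ 0#
  *-unit≡0⇒≡0 {x} {u} (u⁻¹ , uu⁻¹) xu≡0 = begin
    x               ≡⟨ sym (*-identityʳ x) ⟩
    x * 1#          ≡⟨ cong (x *_) (sym uu⁻¹) ⟩
    x * (u * u⁻¹)   ≡⟨ sym (*-assoc x u u⁻¹) ⟩
    (x * u) * u⁻¹   ≡⟨ cong (_* u⁻¹) xu≡0 ⟩
    0# * u⁻¹        ≡⟨ zeroˡ u⁻¹ ⟩
    0#              ∎
    where open ≡-Reasoning

  ⟨_⟩ : Carrier → Carrier → Set
  ⟨ a ⟩ x = ∃ λ r → x ≡ r * a

  ⟨⟩-isIdeal : ∀ a → IsIdeal R ⟨ a ⟩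
  ⟨⟩-isIdeal a = record
    { zero-mem = 0# , sym (zeroˡ a)
    ; +-closed = λ (r , x≡ra) (s , y≡sa) → r + s , trans (cong₂ _+_ x≡ra y≡sa) (sym (distribʳ a r s))
    ; *-closed = λ t (r , x≡ra) → t * r , trans (cong (t *_) x≡ra) (sym (*-assoc t r a))
    }

  a∈⟨a⟩ : ∀ a → ⟨ a ⟩ a
  a∈⟨a⟩ a = 1# , sym (*-identityˡ a)

  module Local (local : IsLocal R) where

    𝔪 : Carrier → Set
    𝔪 = proj₁ local

    𝔪-isIdeal : IsIdeal R 𝔪
    𝔪-isIdeal = proj₁ (proj₁ (proj₂ local))

    1∉𝔪 : ¬ 𝔪 1#
    1∉𝔪 = proj₁ (proj₂ (proj₁ (proj₂ local)))

    maximal⇒⊆𝔪 : ∀ {M} → IsMaximalIdeal R M → ∀ {x} → M x → 𝔪 x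
    maximal⇒⊆𝔪 M-max {x} = proj₁ (proj₂ (proj₂ local) _ M-max) x

    -- Ideals are arbitrary predicates, so 𝔪 ∪ {x ∣ P} is an ideal for every
    -- proposition P; maximality of 𝔪 then decides P.
    em : ExcludedMiddle 0ℓ
    em {P} with proj₂ (proj₂ (proj₁ (proj₂ local))) (λ x → 𝔪 x ⊎ P) 𝔪∪P-isIdeal (λ x → inj₁)
      where
      open IsIdeal 𝔪-isIdeal
      𝔪∪P-isIdeal : IsIdeal R (λ x → 𝔪 x ⊎ P)
      𝔪∪P-isIdeal = record
        { zero-mem = inj₁ zero-mem
        ; +-closed = λ { (inj₁ x) (inj₁ y) → inj₁ (+-closed x y)
                       ; (inj₂ p) _        → inj₂ p
                       ; _        (inj₂ p) → inj₂ p }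
        ; *-closed = λ { r (inj₁ x) → inj₁ (*-closed r x) ; r (inj₂ p) → inj₂ p }
        }
    ... | inj₁ ⊆𝔪         = no λ p → 1∉𝔪 (⊆𝔪 1# (inj₂ p))
    ... | inj₂ (inj₁ 1∈𝔪) = contradiction 1∈𝔪 1∉𝔪
    ... | inj₂ (inj₂ p)   = yes p

    1≢0 : 1# ≢ 0#
    1≢0 1≡0 = 1∉𝔪 (subst 𝔪 (sym 1≡0) (IsIdeal.zero-mem 𝔪-isIdeal))

    module PrincipalIdealRing (pir : IsPIR R) where

      open Classical em

      largest-nonunit-⟨⟩⊆𝔪 : ∀ {a} → ¬ Unit a →
        (∀ {b} → ¬ Unit b → (∀ {y} → ⟨ a ⟩ y → ⟨ b ⟩ y) →
                 count ⟨ b ⟩ elements ≤ count ⟨ a ⟩ elements) →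
        ∀ {y} → ⟨ a ⟩ y → 𝔪 y
      largest-nonunit-⟨⟩⊆𝔪 {a} ¬unit-a largest = maximal⇒⊆𝔪 (⟨⟩-isIdeal a , 1∉⟨a⟩ , maximal)
        where
        1∉⟨a⟩ : ¬ ⟨ a ⟩ 1#
        1∉⟨a⟩ (r , 1≡ra) = ¬unit-a (r , trans (*-comm a r) (sym 1≡ra))

        maximal : ∀ J → IsIdeal R J → (∀ y → ⟨ a ⟩ y → J y) → (∀ y → J y → ⟨ a ⟩ y) ⊎ J 1#
        maximal J J-isIdeal ⟨a⟩⊆J with em {J 1#}
        ... | yes 1∈J = inj₂ 1∈J
        ... | no  1∉J = inj₁ J⊆⟨a⟩
          where
          b : Carrier
          b = proj₁ (pir J J-isIdeal)
          J⇔⟨b⟩ : ∀ y → J y ⇔ ⟨ b ⟩ y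
          J⇔⟨b⟩ = proj₂ (pir J J-isIdeal)
          ⟨a⟩⊆⟨b⟩ : ∀ {y} → ⟨ a ⟩ y → ⟨ b ⟩ y
          ⟨a⟩⊆⟨b⟩ {y} = Equivalence.to (J⇔⟨b⟩ y) ∘ ⟨a⟩⊆J y
          ¬unit-b : ¬ Unit b
          ¬unit-b (c , bc≡1) = 1∉J (subst J (trans (*-comm c b) bc≡1)
            (IsIdeal.*-closed J-isIdeal c (Equivalence.from (J⇔⟨b⟩ b) (a∈⟨a⟩ b))))
          J⊆⟨a⟩ : ∀ y → J y → ⟨ a ⟩ y
          J⊆⟨a⟩ y Jy with em {⟨ a ⟩ y}
          ... | yes y∈⟨a⟩ = y∈⟨a⟩
          ... | no  y∉⟨a⟩ = contradiction (largest ¬unit-b ⟨a⟩⊆⟨b⟩)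
            (ℕ.<⇒≱ (count-mono-< ⟨a⟩⊆⟨b⟩ (∈-elements y) (Equivalence.to (J⇔⟨b⟩ y) Jy) y∉⟨a⟩))

      ¬unit⇒∈𝔪 : ∀ {x} → ¬ Unit x → 𝔪 x
      ¬unit⇒∈𝔪 {x} ¬unit-x = largest-nonunit-⟨⟩⊆𝔪 (proj₁ a-candidate) a-largest (proj₂ a-candidate)
        where
        Candidate : Carrier → Set
        Candidate b = ¬ Unit b × ⟨ b ⟩ x
        candidate? : Decidable Candidate
        candidate? _ = em
        size : Carrier → ℕ
        size b = count ⟨ b ⟩ elements
        candidates : List Carrier
        candidates = filter candidate? elements
        a : Carrier
        a = argmax size x candidates
        a-candidate : Candidate a
        a-candidate = argmax-all size (¬unit-x , a∈⟨a⟩ x) (all-filter candidate? elements)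
        a-largest : ∀ {b} → ¬ Unit b → (∀ {y} → ⟨ a ⟩ y → ⟨ b ⟩ y) → size b ≤ size a
        a-largest ¬unit-b ⟨a⟩⊆⟨b⟩ = lookup (f[xs]≤f[argmax] x candidates)
          (∈-filter⁺ candidate? (∈-elements _) (¬unit-b , ⟨a⟩⊆⟨b⟩ (proj₂ a-candidate)))

      1-𝔪-unit : ∀ {m} → 𝔪 m → Unit (1# + - m)
      1-𝔪-unit {m} m∈𝔪 with em {Unit (1# + - m)}
      ... | yes unit = unit
      ... | no ¬unit =
        contradiction (subst 𝔪 1-m+m≡1 (IsIdeal.+-closed 𝔪-isIdeal (¬unit⇒∈𝔪 ¬unit) m∈𝔪)) 1∉𝔪
        where
        1-m+m≡1 : (1# + - m) + m ≡ 1#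
        1-m+m≡1 = trans (+-assoc 1# (- m) m) (trans (cong (1# +_) (-‿inverseˡ m)) (+-identityʳ 1#))

      ≡*𝔪⇒≡0 : ∀ {x m} → 𝔪 m → x ≡ x * m → x ≡ 0#
      ≡*𝔪⇒≡0 {x} {m} m∈𝔪 x≡xm = *-unit≡0⇒≡0 (1-𝔪-unit m∈𝔪) (begin
        x * (1# + - m)      ≡⟨ distribˡ x 1# (- m) ⟩
        x * 1# + x * - m    ≡⟨ cong₂ _+_ (*-identityʳ x) (sym (-‿distribʳ-* x m)) ⟩
        x + - (x * m)       ≡⟨ cong (λ y → x + - y) (sym x≡xm) ⟩
        x + - x             ≡⟨ -‿inverseʳ x ⟩
        0#                  ∎)
        where open ≡-Reasoning

      π : Carrier
      π = proj₁ (pir 𝔪 𝔪-isIdeal)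

      𝔪⇔⟨π⟩ : ∀ x → 𝔪 x ⇔ ⟨ π ⟩ x
      𝔪⇔⟨π⟩ = proj₂ (pir 𝔪 𝔪-isIdeal)

      π^suc∈𝔪 : ∀ k → 𝔪 (π ^ suc k)
      π^suc∈𝔪 k = subst 𝔪 (*-comm (π ^ k) π)
        (IsIdeal.*-closed 𝔪-isIdeal (π ^ k) (Equivalence.from (𝔪⇔⟨π⟩ π) (a∈⟨a⟩ π)))

      -- Opaque: n comes out of a search which type checking must never unfold.
      opaque
        π-nilpotent : ∃ λ N → π ^ N ≡ 0#
        π-nilpotent with pigeonhole (ℕ.n<1+n card) (λ i → Inverse.from enum (π ^ toℕ i))
        ... | i , j , i<j , π^i≈π^j with ℕ.m≤n⇒∃[o]m+o≡n i<j
        ... | o , i+1+o≡j = toℕ i , ≡*𝔪⇒≡0 (π^suc∈𝔪 o) (begin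
          π ^ toℕ i                     ≡⟨ from-injective π^i≈π^j ⟩
          π ^ toℕ j                     ≡⟨ cong (π ^_) (sym (trans (ℕ.+-suc (toℕ i) o) i+1+o≡j)) ⟩
          π ^ (toℕ i ℕ.+ suc o)         ≡⟨ ^-homo-* π (toℕ i) (suc o) ⟩
          π ^ toℕ i * π ^ suc o         ∎)
          where open ≡-Reasoning

        nilpotency : ∃ (IsLeast (λ k → π ^ k ≡ 0#))
        nilpotency = least (proj₁ π-nilpotent) (proj₂ π-nilpotent)

      n : ℕ
      n = proj₁ nilpotency

      π^≥n≡0 : ∀ {k} → n ≤ k → π ^ k ≡ 0#
      π^≥n≡0 {k} n≤k with ℕ.m≤n⇒∃[o]m+o≡n n≤k
      ... | o , refl = begin
        π ^ (n ℕ.+ o)  ≡⟨ ^-homo-* π n o ⟩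
        π ^ n * π ^ o  ≡⟨ cong (_* π ^ o) (proj₁ (proj₂ nilpotency)) ⟩
        0# * π ^ o     ≡⟨ zeroˡ (π ^ o) ⟩
        0#             ∎
        where open ≡-Reasoning

      π^*unit≡0⇔ : ∀ {k u} → Unit u → π ^ k * u ≡ 0# ⇔ n ≤ k
      π^*unit≡0⇔ {k} {u} unit = mk⇔
        (λ π^ku≡0 → ℕ.≮⇒≥ λ k<n → proj₂ (proj₂ nilpotency) k<n (*-unit≡0⇒≡0 unit π^ku≡0))
        (λ n≤k → trans (cong (_* u) (π^≥n≡0 n≤k)) (zeroˡ u))

      record Factorisation (b : Carrier) : Set where
        field
          exponent   : ℕ
          exponent<n : exponent < n
          unit       : Carrier
          isUnit     : Unit unit
          factorises : b ≡ π ^ exponent * unit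

      factorise-below : ∀ f b → (∃ λ k → k < f × ∃ λ u → Unit u × b ≡ π ^ k * u) ⊎ ⟨ π ^ f ⟩ b
      factorise-below zero    b = inj₂ (b , sym (*-identityʳ b))
      factorise-below (suc f) b with factorise-below f b
      ... | inj₁ (k , k<f , rest) = inj₁ (k , ℕ.m<n⇒m<1+n k<f , rest)
      ... | inj₂ (c , b≡cπ^f) with em {Unit c}
      ... | yes unit-c = inj₁ (f , ℕ.n<1+n f , c , unit-c , trans b≡cπ^f (*-comm c (π ^ f)))
      ... | no ¬unit-c with Equivalence.to (𝔪⇔⟨π⟩ c) (¬unit⇒∈𝔪 ¬unit-c)
      ... | r , c≡rπ = inj₂ (r , (begin
        b                ≡⟨ b≡cπ^f ⟩
        c * π ^ f        ≡⟨ cong (_* π ^ f) c≡rπ ⟩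
        r * π * π ^ f    ≡⟨ *-assoc r π (π ^ f) ⟩
        r * π ^ suc f    ∎))
        where open ≡-Reasoning

      factorise : ∀ b → b ≡ 0# ⊎ Factorisation b
      factorise b with factorise-below n b
      ... | inj₁ (k , k<n , u , unit-u , b≡) = inj₂ (record
        { exponent = k ; exponent<n = k<n ; unit = u ; isUnit = unit-u ; factorises = b≡ })
      ... | inj₂ (c , b≡cπ^n) = inj₁ (trans b≡cπ^n (trans (cong (c *_) (π^≥n≡0 ℕ.≤-refl)) (zeroʳ c)))

      ν : Carrier → ℕ
      ν b with factorise b
      ... | inj₁ _ = n
      ... | inj₂ φ = Factorisation.exponent φ

      ν<n : ∀ {b} → b ≢ 0# → ν b < n
      ν<n {b} b≢0 with factorise b
      ... | inj₁ b≡0 = contradiction b≡0 b≢0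
      ... | inj₂ φ   = Factorisation.exponent<n φ

      *≡0⇔n≤ν+ν : ∀ b c → b * c ≡ 0# ⇔ n ≤ ν b ℕ.+ ν c
      *≡0⇔n≤ν+ν b c with factorise b | factorise c
      ... | inj₁ b≡0 | _ = mk⇔ (λ _ → ℕ.m≤m+n n _) (λ _ → trans (cong (_* c) b≡0) (zeroˡ c))
      ... | inj₂ _ | inj₁ c≡0 = mk⇔ (λ _ → ℕ.m≤n+m n _) (λ _ → trans (cong (b *_) c≡0) (zeroʳ b))
      ... | inj₂ φ | inj₂ ψ = subst (λ x → x ≡ 0# ⇔ n ≤ exponent φ ℕ.+ exponent ψ) (sym bc≡)
        (π^*unit≡0⇔ (unit-* (isUnit φ) (isUnit ψ)))
        where
        open Factorisation
        open ≡-Reasoning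
        bc≡ : b * c ≡ π ^ (exponent φ ℕ.+ exponent ψ) * (unit φ * unit ψ)
        bc≡ = begin
          b * c
            ≡⟨ cong₂ _*_ (factorises φ) (factorises ψ) ⟩
          (π ^ exponent φ * unit φ) * (π ^ exponent ψ * unit ψ)
            ≡⟨ interchange _ _ _ _ ⟩
          (π ^ exponent φ * π ^ exponent ψ) * (unit φ * unit ψ)
            ≡⟨ cong (_* _) (sym (^-homo-* π (exponent φ) (exponent ψ))) ⟩
          π ^ (exponent φ ℕ.+ exponent ψ) * (unit φ * unit ψ)
            ∎

module Orientations (G : Graph) where

  open Graph G

  Edge : V → V → Set
  Edge u v = Vert u × Vert v × u ≢ v × Adj u v

  record TransitiveOrientation : Set₁ where
    infix 4 _⇝_
    field
      _⇝_     : V → V → Set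
      ⇝⇒Edge  : ∀ {u v} → u ⇝ v → Edge u v
      ⇝-trans : ∀ {u v w} → u ⇝ v → v ⇝ w → u ⇝ w
      Edge⇒⇝  : ∀ {u v} → Edge u v → u ⇝ v ⊎ v ⇝ u

    ⇝-irrefl : ∀ {u} → ¬ u ⇝ u
    ⇝-irrefl u⇝u = proj₁ (proj₂ (proj₂ (⇝⇒Edge u⇝u))) refl

    ⇝-forceʳ : ∀ {a b c} → a ⇝ b → Edge a c → ¬ Edge c b → a ⇝ c
    ⇝-forceʳ a⇝b ac ¬cb with Edge⇒⇝ ac
    ... | inj₁ a⇝c = a⇝c
    ... | inj₂ c⇝a = contradiction (⇝⇒Edge (⇝-trans c⇝a a⇝b)) ¬cb

    ⇝-forceˡ : ∀ {a b c} → a ⇝ b → Edge c b → ¬ Edge a c → c ⇝ b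
    ⇝-forceˡ a⇝b cb ¬ac with Edge⇒⇝ cb
    ... | inj₁ c⇝b = c⇝b
    ... | inj₂ b⇝c = contradiction (⇝⇒Edge (⇝-trans a⇝b b⇝c)) ¬ac

  reverse : (∀ {u v} → Edge u v → Edge v u) → TransitiveOrientation → TransitiveOrientation
  reverse Edge-sym O = record
    { _⇝_     = λ u v → v ⇝ u
    ; ⇝⇒Edge  = λ v⇝u → Edge-sym (⇝⇒Edge v⇝u)
    ; ⇝-trans = λ v⇝u w⇝v → ⇝-trans w⇝v v⇝u
    ; Edge⇒⇝  = λ uv → swap (Edge⇒⇝ uv)
    }
    where open TransitiveOrientation O

  module _ (divisor : IsDivisorGraph G) where

    private
      ι : V → ℕ
      ι = proj₁ divisor
      ι-injective : ∀ u v → Vert u → Vert v → ι u ≡ ι v → u ≡ v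
      ι-injective = proj₁ (proj₂ (proj₂ divisor))
      Adj⇔ι-comparable : ∀ u v → Vert u → Vert v → u ≢ v → Adj u v ⇔ (ι u ∣ ι v ⊎ ι v ∣ ι u)
      Adj⇔ι-comparable = proj₂ (proj₂ (proj₂ divisor))

    divisorGraph⇒Edge-sym : ∀ {u v} → Edge u v → Edge v u
    divisorGraph⇒Edge-sym (u-vert , v-vert , u≢v , uv) = v-vert , u-vert , v≢u ,
      Equivalence.from (Adj⇔ι-comparable _ _ v-vert u-vert v≢u)
        (swap (Equivalence.to (Adj⇔ι-comparable _ _ u-vert v-vert u≢v) uv))
      where
      v≢u : _ ≢ _
      v≢u = u≢v ∘ sym

    divisorGraph⇒orientation : TransitiveOrientation
    divisorGraph⇒orientation = record
      { _⇝_     = _⇝_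
      ; ⇝⇒Edge  = proj₁
      ; ⇝-trans = ⇝-trans
      ; Edge⇒⇝  = Edge⇒⇝
      }
      where
      _⇝_ : V → V → Set
      u ⇝ v = Edge u v × ι u ∣ ι v

      ⇝-trans : ∀ {u v w} → u ⇝ v → v ⇝ w → u ⇝ w
      ⇝-trans {u} {v} {w} ((u-vert , v-vert , u≢v , _) , ιu∣ιv) ((_ , w-vert , _ , _) , ιv∣ιw) =
        (u-vert , w-vert , u≢w , Equivalence.from (Adj⇔ι-comparable u w u-vert w-vert u≢w) (inj₁ ιu∣ιw)) ,
        ιu∣ιw
        where
        ιu∣ιw : ι u ∣ ι w
        ιu∣ιw = ∣-trans ιu∣ιv ιv∣ιw
        u≢w : u ≢ w
        u≢w refl = u≢v (ι-injective u v u-vert v-vert (∣-antisym ιu∣ιv ιv∣ιw))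

      Edge⇒⇝ : ∀ {u v} → Edge u v → u ⇝ v ⊎ v ⇝ u
      Edge⇒⇝ uv@(u-vert , v-vert , u≢v , adj)
        with Equivalence.to (Adj⇔ι-comparable _ _ u-vert v-vert u≢v) adj
      ... | inj₁ ιu∣ιv = inj₁ (uv , ιu∣ιv)
      ... | inj₂ ιv∣ιu = inj₂ (divisorGraph⇒Edge-sym uv , ιv∣ιu)

open Orientations

module Product (R₁ R₂ : FiniteCommRing) where

  module R₁ = FiniteCommRingProperties R₁
  module R₂ = FiniteCommRingProperties R₂

  V : Set
  V = R₁.Carrier × R₂.Carrier

  open Graph (Γᶜ-× R₁ R₂) public using (Vert; Adj)

  infixl 7 _·_

  _·_ : V → V → V
  (a , b) · (a′ , b′) = a R₁.* a′ , b R₂.* b′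

  𝟘 : V
  𝟘 = R₁.0# , R₂.0#

  ·-comm : ∀ u v → u · v ≡ v · u
  ·-comm (a , b) (a′ , b′) = cong₂ _,_ (R₁.*-comm a a′) (R₂.*-comm b b′)

  Edge× : V → V → Set
  Edge× = Edge (Γᶜ-× R₁ R₂)

  vertex : ∀ {u} c → c ≢ 𝟘 → u · c ≡ 𝟘 → u ≢ 𝟘 → Vert u
  vertex c c≢𝟘 uc≡𝟘 u≢𝟘 = (c , c≢𝟘 , uc≡𝟘) , u≢𝟘

  edge : ∀ {u v} → Vert u → Vert v → u ≢ v → u · v ≢ 𝟘 → Edge× u v
  edge u-vert v-vert u≢v uv≢𝟘 = u-vert , v-vert , u≢v , u-vert , v-vert , u≢v , uv≢𝟘

  ·≡𝟘⇒¬Edge : ∀ {u v} → u · v ≡ 𝟘 → ¬ Edge× u v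
  ·≡𝟘⇒¬Edge uv≡𝟘 (_ , _ , _ , _ , _ , _ , uv≢𝟘) = uv≢𝟘 uv≡𝟘

  Edge×-sym : ∀ {u v} → Edge× u v → Edge× v u
  Edge×-sym {u} {v} (u-vert , v-vert , u≢v , _ , _ , _ , uv≢𝟘) =
    edge v-vert u-vert (u≢v ∘ sym) (uv≢𝟘 ∘ trans (·-comm u v))

  ≢ˡ : ∀ {a a′ b b′} → a ≢ a′ → _≢_ {A = V} (a , b) (a′ , b′)
  ≢ˡ a≢a′ = a≢a′ ∘ ,-injectiveˡ

  ≢ʳ : ∀ {a a′ b b′} → b ≢ b′ → _≢_ {A = V} (a , b) (a′ , b′)
  ≢ʳ b≢b′ = b≢b′ ∘ ,-injectiveʳ

module Backward (R₁ R₂ : FiniteCommRing) (domain : IsIntegralDomain R₁)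
                (local₂ : IsLocal R₂) (pir₂ : IsPIR R₂) where

  open ExponentVectors
  open Product R₁ R₂
  open R₂.Local local₂ using (em)
  open R₂.Local.PrincipalIdealRing local₂ pir₂ using (n; ν; ν<n; *≡0⇔n≤ν+ν)

  E : ℕ
  E = R₁.card ℕ.* R₂.card

  position : V → ℕ
  position (a , b) = toℕ (combine (Inverse.from R₁.enum a) (Inverse.from R₂.enum b))

  position<E : ∀ v → position v < E
  position<E (a , b) = toℕ<n (combine (Inverse.from R₁.enum a) (Inverse.from R₂.enum b))

  position-injective : ∀ {u v} → position u ≡ position v → u ≡ v
  position-injective {_ , _} {_ , _} eq with combine-injective _ _ _ _ (toℕ-injective eq)
  ... | a≈a′ , b≈b′ = cong₂ _,_ (R₁.from-injective a≈a′) (R₂.from-injective b≈b′)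

  open Realizer n E

  tag : V → Tag
  tag (a , b) with em {a ≡ R₁.0#}
  ... | yes _ = α (ν b) (position (a , b))
  ... | no  _ = β (ν b) (position (a , b))

  index-tag : ∀ v → index (tag v) ≡ position v
  index-tag (a , b) with em {a ≡ R₁.0#}
  ... | yes _ = refl
  ... | no  _ = refl

  tag-valid : ∀ {v} → v ≢ 𝟘 → Valid (tag v)
  tag-valid {a , b} v≢𝟘 with em {a ≡ R₁.0#}
  ... | yes a≡0 = ν<n (λ b≡0 → v≢𝟘 (cong₂ _,_ a≡0 b≡0)) , position<E (a , b)
  ... | no  _   = position<E (a , b)

  *≢0⇔ν+ν<n : ∀ b c → b R₂.* c ≢ R₂.0# ⇔ ν b ℕ.+ ν c < n
  *≢0⇔ν+ν<n b c = mk⇔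
    (λ bc≢0 → ℕ.≰⇒> (bc≢0 ∘ Equivalence.from (*≡0⇔n≤ν+ν b c)))
    (λ ν+ν<n → ℕ.<⇒≱ ν+ν<n ∘ Equivalence.to (*≡0⇔n≤ν+ν b c))

  ·≢𝟘⇔ν+ν<n : ∀ {a b a′ b′} → a R₁.* a′ ≡ R₁.0# → (a , b) · (a′ , b′) ≢ 𝟘 ⇔ ν b ℕ.+ ν b′ < n
  ·≢𝟘⇔ν+ν<n {b = b} {b′ = b′} aa′≡0 = mk⇔
    (λ uv≢𝟘 → Equivalence.to (*≢0⇔ν+ν<n b b′) (uv≢𝟘 ∘ cong₂ _,_ aa′≡0))
    (λ ν+ν<n → Equivalence.from (*≢0⇔ν+ν<n b b′) ν+ν<n ∘ ,-injectiveʳ)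

  ·≢𝟘⇔compatible : ∀ u v → u · v ≢ 𝟘 ⇔ Compatible (tag u) (tag v)
  ·≢𝟘⇔compatible (a , b) (a′ , b′) with em {a ≡ R₁.0#} | em {a′ ≡ R₁.0#}
  ... | yes a≡0 | yes _ = ·≢𝟘⇔ν+ν<n (trans (cong (R₁._* a′) a≡0) (R₁.zeroˡ a′))
  ... | yes a≡0 | no  _ = ·≢𝟘⇔ν+ν<n (trans (cong (R₁._* a′) a≡0) (R₁.zeroˡ a′))
  ... | no  _ | yes a′≡0 = ·≢𝟘⇔ν+ν<n (trans (cong (a R₁.*_) a′≡0) (R₁.zeroʳ a))
  ... | no a≢0 | no a′≢0 =
    mk⇔ (λ _ → tt) λ _ uv≡𝟘 → [ a≢0 , a′≢0 ] (proj₂ domain a a′ (,-injectiveˡ uv≡𝟘))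

  ι : V → ℕ
  ι v = monomial (code (tag v))

  index-tag-injective : ∀ {u v} → index (tag u) ≡ index (tag v) → u ≡ v
  index-tag-injective {u} {v} eq =
    position-injective (trans (sym (index-tag u)) (trans eq (index-tag v)))

  ι-comparable⇔·≢𝟘 : ∀ {u v} → u ≢ 𝟘 → v ≢ 𝟘 → u ≢ v → (ι u ∣ ι v ⊎ ι v ∣ ι u) ⇔ u · v ≢ 𝟘
  ι-comparable⇔·≢𝟘 {u} {v} u≢𝟘 v≢𝟘 u≢v =
    ⇔.trans (monomial∣⇔≤³ ⊎-⇔ monomial∣⇔≤³)
      (⇔.trans (comparable⇔compatible (tag-valid u≢𝟘) (tag-valid v≢𝟘) (u≢v ∘ index-tag-injective))
        (⇔.sym (·≢𝟘⇔compatible u v)))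

  divisorGraph : IsDivisorGraph (Γᶜ-× R₁ R₂)
  divisorGraph = ι , (λ v _ → monomial-pos (code (tag v))) , ι-injective , adjacent⇔ι-comparable
    where
    ι-injective : ∀ u v → Vert u → Vert v → ι u ≡ ι v → u ≡ v
    ι-injective u v (_ , u≢𝟘) (_ , v≢𝟘) ιu≡ιv = index-tag-injective
      (code-injective (tag-valid u≢𝟘) (tag-valid v≢𝟘) (monomial-injective ιu≡ιv))

    adjacent⇔ι-comparable : ∀ u v → Vert u → Vert v → u ≢ v → Adj u v ⇔ (ι u ∣ ι v ⊎ ι v ∣ ι u)
    adjacent⇔ι-comparable u v u-vert@(_ , u≢𝟘) v-vert@(_ , v≢𝟘) u≢v = mk⇔
      (λ (_ , _ , _ , uv≢𝟘) → Equivalence.from ι-comparable⇔uv≢𝟘 uv≢𝟘)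
      (λ comparable → u-vert , v-vert , u≢v , Equivalence.to ι-comparable⇔uv≢𝟘 comparable)
      where
      ι-comparable⇔uv≢𝟘 : (ι u ∣ ι v ⊎ ι v ∣ ι u) ⇔ u · v ≢ 𝟘
      ι-comparable⇔uv≢𝟘 = ι-comparable⇔·≢𝟘 u≢𝟘 v≢𝟘 u≢v

module ZeroDivisorGraph (R : FiniteCommRing) where

  open FiniteCommRingProperties R

  record InducedP₃ : Set where
    field
      x w y       : Carrier
      x≢0         : x ≢ 0#
      w≢0         : w ≢ 0#
      y≢0         : y ≢ 0#
      x≢w         : x ≢ w
      x*w≡0       : x * w ≡ 0#
      w*y≡0       : w * y ≡ 0#
      x*y≢0       : x * y ≢ 0#

  diam≡2⇒InducedP₃ : ExcludedMiddle 0ℓ → HasDiam (Γ R) 2 → InducedP₃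
  diam≡2⇒InducedP₃ em (diam≤2 , 2≤diam)
    with em {∃ λ x → ∃ λ y → ZDVertex _*_ 0# x × ZDVertex _*_ 0# y × ¬ Walk (Γ R) 1 x y}
  ... | no ∄far = contradiction (2≤diam 1 diam≤1) λ { (s≤s ()) }
    where
    diam≤1 : Diam≤ (Γ R) 1
    diam≤1 x y x-vert y-vert with em {Walk (Γ R) 1 x y}
    ... | yes walk = walk
    ... | no ¬walk = contradiction (x , y , x-vert , y-vert , ¬walk) ∄far
  ... | yes (x , y , x-vert , y-vert , ¬walk) = path (diam≤2 x y x-vert y-vert)
    where
    path : Walk (Γ R) 2 x y → InducedP₃
    path here = contradiction here ¬walk
    path (step xy here) = contradiction (step xy here) ¬walk
    path (step {y = w} (_ , w-vert , x≢w , x*w≡0) (step (_ , _ , _ , w*y≡0) here)) = record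
      { x = x ; w = w ; y = y
      ; x≢0 = proj₂ x-vert ; w≢0 = proj₂ w-vert ; y≢0 = proj₂ y-vert
      ; x≢w = x≢w ; x*w≡0 = x*w≡0 ; w*y≡0 = w*y≡0
      ; x*y≢0 = λ x*y≡0 → ¬walk (step (x-vert , y-vert , x≢y , x*y≡0) here)
      }
      where
      x≢y : x ≢ y
      x≢y refl = ¬walk here

  diam≡0⇒*≡0⇒≡ : HasDiam (Γ R) 0 → ∀ {a b} → a ≢ 0# → b ≢ 0# → a * b ≡ 0# → a ≡ b
  diam≡0⇒*≡0⇒≡ (diam≤0 , _) {a} {b} a≢0 b≢0 a*b≡0
    with diam≤0 a b ((b , b≢0 , a*b≡0) , a≢0) ((a , a≢0 , trans (*-comm b a) a*b≡0) , b≢0)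
  ... | here = refl

open ZeroDivisorGraph

module Forward (R₁ R₂ : FiniteCommRing) where

  open Product R₁ R₂

  module _ {z : R₁.Carrier} (z≢0 : z ≢ R₁.0#) (z*z≡0 : z R₁.* z ≡ R₁.0#) (path : InducedP₃ R₂) where

    open InducedP₃ path
    open R₁ using () renaming (0# to 0₁; 1# to 1₁)
    open R₂ using () renaming (0# to 0₂; 1# to 1₂)

    P Q R S T U W Y : V
    P = 1₁ , w
    Q = z  , x
    R = z  , 0₂
    S = 0₁ , 1₂
    T = 0₁ , x
    U = z  , w
    W = 1₁ , 0₂
    Y = 0₁ , y

    1₁≢0 : 1₁ ≢ 0₁
    1₁≢0 = R₁.≢0⇒1≢0 z≢0

    1₂≢0 : 1₂ ≢ 0₂
    1₂≢0 = R₂.≢0⇒1≢0 x≢0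

    x≢1 : x ≢ 1₂
    x≢1 refl = w≢0 (trans (sym (R₂.*-identityˡ w)) x*w≡0)

    w*x≡0 : w R₂.* x ≡ 0₂
    w*x≡0 = trans (R₂.*-comm w x) x*w≡0

    on-R₁-axis : ∀ {a} → a ≢ 0₁ → Vert (a , 0₂)
    on-R₁-axis {a} a≢0 = vertex S (≢ʳ 1₂≢0) (cong₂ _,_ (R₁.zeroʳ a) (R₂.zeroˡ 1₂)) (≢ˡ a≢0)

    on-R₂-axis : ∀ {b} → b ≢ 0₂ → Vert (0₁ , b)
    on-R₂-axis {b} b≢0 = vertex W (≢ˡ 1₁≢0) (cong₂ _,_ (R₁.zeroˡ 1₁) (R₂.zeroʳ b)) (≢ʳ b≢0)

    P-vert : Vert P
    P-vert = vertex T (≢ʳ x≢0) (cong₂ _,_ (R₁.zeroʳ 1₁) w*x≡0) (≢ʳ w≢0)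
    Q-vert : Vert Q
    Q-vert = vertex U (≢ˡ z≢0) (cong₂ _,_ z*z≡0 x*w≡0) (≢ˡ z≢0)
    U-vert : Vert U
    U-vert = vertex Q (≢ˡ z≢0) (cong₂ _,_ z*z≡0 w*x≡0) (≢ˡ z≢0)
    R-vert : Vert R
    R-vert = on-R₁-axis z≢0
    S-vert : Vert S
    S-vert = on-R₂-axis 1₂≢0
    T-vert : Vert T
    T-vert = on-R₂-axis x≢0
    W-vert : Vert W
    W-vert = on-R₁-axis 1₁≢0
    Y-vert : Vert Y
    Y-vert = on-R₂-axis y≢0

    PQ : Edge× P Q
    PQ = edge P-vert Q-vert (≢ʳ (x≢w ∘ sym)) (≢ˡ (R₁.1*≢0 z≢0))

    -- Each step moves one end of the arc to a vertex adjacent to its other end but not to the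
    -- end being moved; transitivity forces the orientation to follow.  The arc travels
    -- P Q, P R, P S, T S, U S, U W, Q W, Q Y and comes back as Q P.
    reversal : (O : TransitiveOrientation (Γᶜ-× R₁ R₂)) → let open TransitiveOrientation O in
               P ⇝ Q → Q ⇝ P
    reversal O P⇝Q =
      let P⇝R = ⇝-forceʳ P⇝Q (edge P-vert R-vert (≢ʳ w≢0) (≢ˡ (R₁.1*≢0 z≢0)))
                  (·≡𝟘⇒¬Edge (cong₂ _,_ z*z≡0 (R₂.zeroˡ x)))
          P⇝S = ⇝-forceʳ P⇝R (edge P-vert S-vert (≢ˡ 1₁≢0) (≢ʳ (R₂.*1≢0 w≢0)))
                  (·≡𝟘⇒¬Edge (cong₂ _,_ (R₁.zeroˡ z) (R₂.zeroʳ 1₂)))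
          T⇝S = ⇝-forceˡ P⇝S (edge T-vert S-vert (≢ʳ x≢1) (≢ʳ (R₂.*1≢0 x≢0)))
                  (·≡𝟘⇒¬Edge (cong₂ _,_ (R₁.zeroʳ 1₁) w*x≡0))
          U⇝S = ⇝-forceˡ T⇝S (edge U-vert S-vert (≢ˡ z≢0) (≢ʳ (R₂.*1≢0 w≢0)))
                  (·≡𝟘⇒¬Edge (cong₂ _,_ (R₁.zeroˡ z) x*w≡0))
          U⇝W = ⇝-forceʳ U⇝S (edge U-vert W-vert (≢ʳ w≢0) (≢ˡ (R₁.*1≢0 z≢0)))
                  (·≡𝟘⇒¬Edge (cong₂ _,_ (R₁.zeroʳ 1₁) (R₂.zeroˡ 1₂)))
          Q⇝W = ⇝-forceˡ U⇝W (edge Q-vert W-vert (≢ʳ x≢0) (≢ˡ (R₁.*1≢0 z≢0)))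
                  (·≡𝟘⇒¬Edge (cong₂ _,_ z*z≡0 w*x≡0))
          Q⇝Y = ⇝-forceʳ Q⇝W (edge Q-vert Y-vert (≢ˡ z≢0) (≢ʳ x*y≢0))
                  (·≡𝟘⇒¬Edge (cong₂ _,_ (R₁.zeroˡ 1₁) (R₂.zeroʳ y)))
      in  ⇝-forceʳ Q⇝Y (edge Q-vert P-vert (≢ʳ x≢w) (≢ˡ (R₁.*1≢0 z≢0)))
                  (·≡𝟘⇒¬Edge (cong₂ _,_ (R₁.zeroʳ 1₁) w*y≡0))
      where open TransitiveOrientation O

    ¬P⇝Q : (O : TransitiveOrientation (Γᶜ-× R₁ R₂)) → let open TransitiveOrientation O in ¬ P ⇝ Q
    ¬P⇝Q O P⇝Q = ⇝-irrefl (⇝-trans P⇝Q (reversal O P⇝Q))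
      where open TransitiveOrientation O

    no-transitive-orientation : ¬ TransitiveOrientation (Γᶜ-× R₁ R₂)
    no-transitive-orientation O =
      [ ¬P⇝Q O , ¬P⇝Q (reverse _ Edge×-sym O) ] (TransitiveOrientation.Edge⇒⇝ O PQ)

  divisorGraph⇒domain : IsLocal R₁ → HasDiam (Γ R₁) 0 → InducedP₃ R₂ →
                        IsDivisorGraph (Γᶜ-× R₁ R₂) → IsIntegralDomain R₁
  divisorGraph⇒domain local₁ diam₁ path divisor = 1≢0 , no-zero-divisors
    where
    open R₁
    open R₁.Local local₁ using (em; 1≢0)
    no-zero-divisors : ∀ a b → a * b ≡ 0# → a ≡ 0# ⊎ b ≡ 0#
    no-zero-divisors a b a*b≡0 with em {a ≡ 0#} | em {b ≡ 0#}
    ... | yes a≡0 | _       = inj₁ a≡0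
    ... | no  _   | yes b≡0 = inj₂ b≡0
    ... | no  a≢0 | no  b≢0 with diam≡0⇒*≡0⇒≡ R₁ diam₁ a≢0 b≢0 a*b≡0
    ... | refl =
      contradiction (divisorGraph⇒orientation _ divisor) (no-transitive-orientation a≢0 a*b≡0 path)

theorem2p5 : (R₁ R₂ : FiniteCommRing) →
    IsLocal R₁ → IsPIR R₁ → IsLocal R₂ → IsPIR R₂ →
    HasDiam (Γ R₁) 0 → HasDiam (Γ R₂) 2 →
    (IsDivisorGraph (Γᶜ-× R₁ R₂) ⇔ IsIntegralDomain R₁)
theorem2p5 R₁ R₂ local₁ _ local₂ pir₂ diam₁ diam₂ =
  mk⇔ (Forward.divisorGraph⇒domain R₁ R₂ local₁ diam₁ (diam≡2⇒InducedP₃ R₂ em diam₂))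
      (λ domain → Backward.divisorGraph R₁ R₂ domain local₂ pir₂)
  where open FiniteCommRingProperties.Local R₂ local₂ using (em)
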